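{- For any graph $G$, the Cartesian product $G\,\Box\,C_5$ has an EOD-set that is parallel with respect to $G$ if and only if $G$ is a $C_5$-parallel amenable graph.
   Context: All graphs are finite and simple; $C_5$ has vertex set $[5]=\{1,\dots,5\}$ with $i$ adjacent to $i\pm1$ modulo 5. An EOD-set of a graph $X$ is a set $D\subseteq V(X)$ with $\bigcup_{v\in D}N(v)=V(X)$ and $N(u)\cap N(v)=\emptyset$ for all distinct $u,v\in D$ ($N$ = open neighborhood). An EOD-set $D$ of $G\,\Box\,H$ is parallel with respect to $G$ if for every edge of the subgraph induced by $D$, its end vertices have distinct $G$-coordinates. For $S\subseteq V(G)$, "$\langle S\rangle$ is a matching" means every vertex of $S$ has exactly one neighbor in $S$ (empty $S$ allowed). A weak partition of a set is a collection of pairwise disjoint, possibly empty, subsets whose union is the set. $G$ is $C_5$-parallel amenable if there is a weak partition $\{V_0,V_1,\dots,V_5\}$ of $V(G)$ such that, with subscripts taken modulo 5 in $[5]$: (A) if $x\in V_0$ then $|N(x)\cap V_i|=1$ for every $i\in[5]$; (B) $\langle V_i\rangle$ is a matching for every $i\in[5]$; (C$'$) $\langle V_i\cup V_{i+1}\rangle$ is a matching for every $i\in[5]$; (D) if $x\in V_i$ ($i\in[5]$), then $|N(x)\cap V_{i+2}|=1$ and $|N(x)\cap V_{i-2}|=1$. -}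

module Defs where

open import Data.Nat using (ℕ)
open import Data.Fin using (Fin; zero; suc)
open import Data.Bool using (Bool; true; false; _∨_)
open import Data.Product using (Σ; _×_; _,_; proj₁; proj₂)
open import Relation.Binary.PropositionalEquality using (_≡_; _≢_)
open import Relation.Nullary using (¬_; yes; no)
open import Data.Fin using (_≟_)
open import Data.Sum using (_⊎_)

record Graph : Set where
  field
    n      : ℕ
    adj    : Fin n → Fin n → Bool
    sym    : ∀ x y → adj x y ≡ adj y x
    irrefl : ∀ x → adj x x ≡ false
open Graph public

ExactlyOne : {V : Set} → (V → Set) → Set
ExactlyOne {V} P = Σ V λ y → P y × (∀ z → P z → z ≡ y)

-- Generic notions over a vertex type V with adjacency A (u ∈ N(v) iff A v u ≡ true).
module _ {V : Set} (A : V → V → Bool) where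

  IsEOD : (V → Bool) → Set
  IsEOD D =
    (∀ u → Σ V λ v → D v ≡ true × A v u ≡ true) ×
    (∀ u v → D u ≡ true → D v ≡ true → u ≢ v →
       ∀ w → ¬ (A u w ≡ true × A v w ≡ true))

  -- ⟨S⟩ is a matching: every vertex of S has exactly one neighbour in S.
  IsMatching : (V → Set) → Set
  IsMatching S = ∀ x → S x → ExactlyOne (λ y → S y × A x y ≡ true)

-- C5 on Fin 5: vertex k ∈ Fin 5 stands for k+1 ∈ [5]. succ5 is +1 mod 5.
succ5 : Fin 5 → Fin 5
succ5 zero = suc zero
succ5 (suc zero) = suc (suc zero)
succ5 (suc (suc zero)) = suc (suc (suc zero))
succ5 (suc (suc (suc zero))) = suc (suc (suc (suc zero)))
succ5 (suc (suc (suc (suc zero)))) = zero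

eqF5 : Fin 5 → Fin 5 → Bool
eqF5 i j with _≟_ i j
... | yes _ = true
... | no _ = false

C5adj : Fin 5 → Fin 5 → Bool
C5adj i j = eqF5 (succ5 i) j ∨ eqF5 (succ5 j) i

plus2 : Fin 5 → Fin 5
plus2 i = succ5 (succ5 i)

minus2 : Fin 5 → Fin 5
minus2 i = succ5 (succ5 (succ5 i))

boxC5adj : (G : Graph) → (Fin (n G) × Fin 5) → (Fin (n G) × Fin 5) → Bool
boxC5adj G (g , i) (h , j) with _≟_ g h | eqF5 i j
... | yes _ | _ = C5adj i j
... | no _ | true = adj G g h
... | no _ | false = false

IsParallel : (G : Graph) → (Fin (n G) × Fin 5 → Bool) → Set
IsParallel G D = ∀ u v → D u ≡ true → D v ≡ true → boxC5adj G u v ≡ true →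
  proj₁ u ≢ proj₁ v

-- Weak partition {V0,...,V5} encoded as a labelling p : V(G) → Fin 6,
-- label zero = V0, label suc i = V_{i+1} (i ∈ Fin 5 standing for i+1 ∈ [5]).
module _ (G : Graph) (p : Fin (n G) → Fin 6) where
  InV : Fin 5 → Fin (n G) → Set
  InV i x = p x ≡ suc i

  CondA : Set
  CondA = ∀ x → p x ≡ zero → ∀ i → ExactlyOne (λ y → adj G x y ≡ true × InV i y)

  CondB : Set
  CondB = ∀ i → IsMatching (adj G) (InV i)

  CondC' : Set
  CondC' = ∀ i → IsMatching (adj G) (λ x → InV i x ⊎ InV (succ5 i) x)

  CondD : Set
  CondD = ∀ i x → InV i x →
    ExactlyOne (λ y → adj G x y ≡ true × InV (plus2 i) y) ×
    ExactlyOne (λ y → adj G x y ≡ true × InV (minus2 i) y)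

C5ParallelAmenable : Graph → Set
C5ParallelAmenable G = Σ (Fin (n G) → Fin 6) λ p → CondA G p × CondB G p × CondC' G p × CondD G p

module Submission where

-- A parallel EOD-set D meets every fibre {g} × C5 in at most one
-- vertex (two D-vertices of a fibre would either be adjacent, which
-- parallelism forbids, or at distance two, so they would share a
-- neighbour).  Hence D is the same thing as a labelling p : V(G) → Fin 6,
-- where p g = 0 says the fibre of g misses D and p g = i+1 says that
-- D ∩ fibre = {(g , i)}; the classes V_i = p⁻¹(i+1) are the weak partition.
-- For such a D, "every vertex of G □ C5 has exactly one D-neighbour"
-- (which is the EOD property) is checked vertex by vertex: a vertex (g , j)
-- whose fibre contributes no D-neighbour must have exactly one G-neighbour
-- of g in V_j (this yields conditions (A), (B), (D)), and a vertex (g , j)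
-- whose fibre already contributes one must have no G-neighbour in V_j
-- (this says that there are no edges between V_i and V_{i+1}).  Finally,
-- given (B), that last condition is equivalent to (C').

open import Defs
open import Data.Fin using (Fin)
open import Data.Bool using (Bool)
open import Data.Product using (Σ; _×_; _,_)
open import Function.Bundles using (_⇔_)

open import Data.Fin using (zero; suc) renaming (_≟_ to _≟F_)
open import Data.Fin.Properties using (suc-injective; 0≢1+n; any?)
open import Data.Bool using (true; false)
open import Data.Bool.Properties using () renaming (_≟_ to _≟B_)
open import Data.Product using (proj₁; proj₂; ∃; swap)
open import Data.Product.Properties using (≡-dec)
open import Data.Sum using (_⊎_; inj₁; inj₂)
open import Data.Empty using (⊥; ⊥-elim)
open import Relation.Nullary using (¬_; Dec; yes; no)
open import Relation.Binary.Definitions using (DecidableEquality)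
open import Relation.Binary.PropositionalEquality as ≡
  using (_≡_; _≢_; refl; trans; cong; subst)
open import Function.Bundles using (mk⇔; Equivalence)

open Equivalence using (to; from)

pred5 : Fin 5 → Fin 5
pred5 i = succ5 (succ5 (succ5 (succ5 i)))

data Offset (i : Fin 5) : Fin 5 → Set where
  same  : Offset i i
  next  : Offset i (succ5 i)
  prev  : Offset i (pred5 i)
  next2 : Offset i (plus2 i)
  prev2 : Offset i (minus2 i)

offset : ∀ i j → Offset i j
offset zero                         zero                         = same
offset zero                         (suc zero)                   = next
offset zero                         (suc (suc zero))             = next2
offset zero                         (suc (suc (suc zero)))       = prev2
offset zero                         (suc (suc (suc (suc zero)))) = prev
offset (suc zero)                   zero                         = prev
offset (suc zero)                   (suc zero)                   = same
offset (suc zero)                   (suc (suc zero))             = next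
offset (suc zero)                   (suc (suc (suc zero)))       = next2
offset (suc zero)                   (suc (suc (suc (suc zero)))) = prev2
offset (suc (suc zero))             zero                         = prev2
offset (suc (suc zero))             (suc zero)                   = prev
offset (suc (suc zero))             (suc (suc zero))             = same
offset (suc (suc zero))             (suc (suc (suc zero)))       = next
offset (suc (suc zero))             (suc (suc (suc (suc zero)))) = next2
offset (suc (suc (suc zero)))       zero                         = next2
offset (suc (suc (suc zero)))       (suc zero)                   = prev2
offset (suc (suc (suc zero)))       (suc (suc zero))             = prev
offset (suc (suc (suc zero)))       (suc (suc (suc zero)))       = same
offset (suc (suc (suc zero)))       (suc (suc (suc (suc zero)))) = next
offset (suc (suc (suc (suc zero)))) zero                         = next
offset (suc (suc (suc (suc zero)))) (suc zero)                   = next2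
offset (suc (suc (suc (suc zero)))) (suc (suc zero))             = prev2
offset (suc (suc (suc (suc zero)))) (suc (suc (suc zero)))       = prev
offset (suc (suc (suc (suc zero)))) (suc (suc (suc (suc zero)))) = same

fin5-cases : (P : Fin 5 → Set) → P zero → P (suc zero) → P (suc (suc zero)) →
  P (suc (suc (suc zero))) → P (suc (suc (suc (suc zero)))) → ∀ i → P i
fin5-cases P p0 p1 p2 p3 p4 zero                         = p0
fin5-cases P p0 p1 p2 p3 p4 (suc zero)                   = p1
fin5-cases P p0 p1 p2 p3 p4 (suc (suc zero))             = p2
fin5-cases P p0 p1 p2 p3 p4 (suc (suc (suc zero)))       = p3
fin5-cases P p0 p1 p2 p3 p4 (suc (suc (suc (suc zero)))) = p4

c5-loopless : ∀ i → C5adj i i ≡ false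
c5-loopless = fin5-cases (λ i → C5adj i i ≡ false) refl refl refl refl refl

c5-next : ∀ i → C5adj i (succ5 i) ≡ true
c5-next = fin5-cases (λ i → C5adj i (succ5 i) ≡ true) refl refl refl refl refl

c5-prev : ∀ i → C5adj i (pred5 i) ≡ true
c5-prev = fin5-cases (λ i → C5adj i (pred5 i) ≡ true) refl refl refl refl refl

c5-far-next : ∀ i → C5adj i (plus2 i) ≡ false
c5-far-next = fin5-cases (λ i → C5adj i (plus2 i) ≡ false) refl refl refl refl refl

c5-far-prev : ∀ i → C5adj i (minus2 i) ≡ false
c5-far-prev = fin5-cases (λ i → C5adj i (minus2 i) ≡ false) refl refl refl refl refl

c5-next-common : ∀ i → C5adj (plus2 i) (succ5 i) ≡ true
c5-next-common = fin5-cases (λ i → C5adj (plus2 i) (succ5 i) ≡ true) refl refl refl refl refl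

c5-prev-common : ∀ i → C5adj (minus2 i) (pred5 i) ≡ true
c5-prev-common = fin5-cases (λ i → C5adj (minus2 i) (pred5 i) ≡ true) refl refl refl refl refl

succ5-pred5 : ∀ i → succ5 (pred5 i) ≡ i
succ5-pred5 = fin5-cases (λ i → succ5 (pred5 i) ≡ i) refl refl refl refl refl

succ5-no-fixpoint : ∀ i → i ≢ succ5 i
succ5-no-fixpoint = fin5-cases (λ i → i ≢ succ5 i) (λ ()) (λ ()) (λ ()) (λ ()) (λ ())

exactlyOne-map : {V : Set} {P Q : V → Set} → (∀ y → P y → Q y) → (∀ y → Q y → P y) →
  ExactlyOne P → ExactlyOne Q
exactlyOne-map f g (y , py , unique) = y , f y py , λ z qz → unique z (g z qz)

module _ {V : Set} (A : V → V → Bool) where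

  Dominates : (V → Bool) → V → V → Set
  Dominates D u v = D v ≡ true × A v u ≡ true

  UniquelyDominated : (V → Bool) → Set
  UniquelyDominated D = ∀ u → ExactlyOne (Dominates D u)

  eod⇔uniquelyDominated : DecidableEquality V → (D : V → Bool) →
    IsEOD A D ⇔ UniquelyDominated D
  eod⇔uniquelyDominated _≟V_ D = mk⇔ unique cover-disjoint
    where
    unique : IsEOD A D → UniquelyDominated D
    unique (cover , disjoint) u with cover u
    ... | v , dom-v = v , dom-v , only-v
      where
      only-v : ∀ w → Dominates D u w → w ≡ v
      only-v w dom-w with w ≟V v
      ... | yes w≡v = w≡v
      ... | no  w≢v = ⊥-elim (disjoint w v (proj₁ dom-w) (proj₁ dom-v) w≢v u
                                (proj₂ dom-w , proj₂ dom-v))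

    cover-disjoint : UniquelyDominated D → IsEOD A D
    cover-disjoint uniq = cover , disjoint
      where
      cover : ∀ u → Σ V (Dominates D u)
      cover u = proj₁ (uniq u) , proj₁ (proj₂ (uniq u))
      disjoint : ∀ u v → D u ≡ true → D v ≡ true → u ≢ v →
        ∀ w → ¬ (A u w ≡ true × A v w ≡ true)
      disjoint u v du dv u≢v w (uw , vw) =
        u≢v (trans (only u (du , uw)) (≡.sym (only v (dv , vw))))
        where
        only : ∀ v → Dominates D w v → v ≡ proj₁ (uniq w)
        only = proj₂ (proj₂ (uniq w))

  NoEdgesBetween : (V → Set) → (V → Set) → Set
  NoEdgesBetween S T = ∀ x y → S x → T y → A x y ≡ true → ⊥

  matching-∪⇔noEdges : (∀ x y → A x y ≡ true → A y x ≡ true) →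
    {S T : V → Set} → (∀ x → S x → T x → ⊥) →
    IsMatching A S → IsMatching A T →
    IsMatching A (λ x → S x ⊎ T x) ⇔ NoEdgesBetween S T
  matching-∪⇔noEdges A-sym {S} {T} disjoint matchS matchT = mk⇔ noEdges matching
    where
    noEdges : IsMatching A (λ x → S x ⊎ T x) → NoEdgesBetween S T
    noEdges matchST x z sx tz xz with matchS x sx | matchST x (inj₁ sx)
    ... | y , (sy , xy) , _ | _ , _ , only = disjoint z (subst S (≡.sym z≡y) sy) tz
      where
      z≡y : z ≡ y
      z≡y = trans (only z (inj₂ tz , xz)) (≡.sym (only y (inj₁ sy , xy)))

    matching : NoEdgesBetween S T → IsMatching A (λ x → S x ⊎ T x)
    matching none x (inj₁ sx) with matchS x sx
    ... | y , (sy , xy) , only = y , (inj₁ sy , xy) , λ where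
      z (inj₁ sz , xz) → only z (sz , xz)
      z (inj₂ tz , xz) → ⊥-elim (none x z sx tz xz)
    matching none x (inj₂ tx) with matchT x tx
    ... | y , (ty , xy) , only = y , (inj₂ ty , xy) , λ where
      z (inj₁ sz , xz) → ⊥-elim (none z x sz tx (A-sym x z xz))
      z (inj₂ tz , xz) → only z (tz , xz)

eqF5-true : ∀ i j → eqF5 i j ≡ true → i ≡ j
eqF5-true i j e with i ≟F j
... | yes i≡j = i≡j

eqF5-refl : ∀ i → eqF5 i i ≡ true
eqF5-refl i with i ≟F i
... | yes _   = refl
... | no  i≢i = ⊥-elim (i≢i refl)

module _ (G : Graph) where

  adj-sym : ∀ x y → adj G x y ≡ true → adj G y x ≡ true
  adj-sym x y xy = trans (Graph.sym G y x) xy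

  adj-irrefl : ∀ x y → adj G x y ≡ true → x ≢ y
  adj-irrefl x .x xx refl with () ← trans (≡.sym xx) (irrefl G x)

  box-cases : ∀ g i h j → boxC5adj G (g , i) (h , j) ≡ true →
    (g ≡ h × C5adj i j ≡ true) ⊎ (i ≡ j × adj G g h ≡ true)
  box-cases g i h j e with g ≟F h | eqF5 i j in i=j
  ... | yes g≡h | _    = inj₁ (g≡h , e)
  ... | no  _   | true = inj₂ (eqF5-true i j i=j , e)

  box-fibre : ∀ g i j → C5adj i j ≡ true → boxC5adj G (g , i) (g , j) ≡ true
  box-fibre g i j ij with g ≟F g
  ... | yes _   = ij
  ... | no  g≢g = ⊥-elim (g≢g refl)

  box-layer : ∀ g h i → adj G g h ≡ true → boxC5adj G (g , i) (h , i) ≡ true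
  box-layer g h i gh with g ≟F h | eqF5 i i in i=i
  ... | yes g≡h | _     = ⊥-elim (adj-irrefl g h gh g≡h)
  ... | no  _   | true  = gh
  ... | no  _   | false with () ← trans (≡.sym (eqF5-refl i)) i=i

AtMostOncePerFibre : {X : Set} → (X × Fin 5 → Bool) → Set
AtMostOncePerFibre D = ∀ g i j → D (g , i) ≡ true → D (g , j) ≡ true → i ≡ j

record Encodes {X : Set} (p : X → Fin 6) (D : X × Fin 5 → Bool) : Set where
  field
    mark  : ∀ g i → p g ≡ suc i → D (g , i) ≡ true
    label : ∀ g i → D (g , i) ≡ true → p g ≡ suc i

  fibre-unique : AtMostOncePerFibre D
  fibre-unique g i j di dj = suc-injective (trans (≡.sym (label g i di)) (label g j dj))

setOf : {X : Set} → (X → Fin 6) → X × Fin 5 → Bool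
setOf p (g , i) with p g ≟F suc i
... | yes _ = true
... | no  _ = false

setOf-encodes : {X : Set} (p : X → Fin 6) → Encodes p (setOf p)
setOf-encodes p = record { mark = mark ; label = label }
  where
  mark : ∀ g i → p g ≡ suc i → setOf p (g , i) ≡ true
  mark g i pg with p g ≟F suc i
  ... | yes _  = refl
  ... | no  ne = ⊥-elim (ne pg)
  label : ∀ g i → setOf p (g , i) ≡ true → p g ≡ suc i
  label g i _ with p g ≟F suc i
  ... | yes pg = pg

module _ {X : Set} (D : X × Fin 5 → Bool) (once : AtMostOncePerFibre D) where

  labelFrom : ∀ g → Dec (∃ λ i → D (g , i) ≡ true) → Fin 6
  labelFrom g (yes (i , _)) = suc i
  labelFrom g (no _)        = zero

  labelOf : X → Fin 6
  labelOf g = labelFrom g (any? (λ i → D (g , i) ≟B true))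

  labelOf-encodes : Encodes labelOf D
  labelOf-encodes = record
    { mark  = λ g → mark g (any? (λ i → D (g , i) ≟B true))
    ; label = λ g → label g (any? (λ i → D (g , i) ≟B true)) }
    where
    mark : ∀ g d i → labelFrom g d ≡ suc i → D (g , i) ≡ true
    mark g (yes (i , di)) .i refl = di
    label : ∀ g d i → D (g , i) ≡ true → labelFrom g d ≡ suc i
    label g (yes (k , dk)) i di = cong suc (once g k i dk di)
    label g (no none)      i di = ⊥-elim (none (i , di))

module _ (G : Graph) where

  -- A set encoded by a labelling is parallel: it has no two vertices in a
  -- common fibre, and edges outside fibres join distinct G-coordinates.
  encoded-parallel : {p : Fin (n G) → Fin 6} {D : Fin (n G) × Fin 5 → Bool} →
    Encodes p D → IsParallel G D
  encoded-parallel enc (g , i) (h , j) di dj e g≡h with box-cases G g i h j e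
  ... | inj₁ (refl , ij) with refl ← Encodes.fibre-unique enc g i j di dj
    with () ← trans (≡.sym ij) (c5-loopless i)
  ... | inj₂ (refl , gh) = adj-irrefl G g h gh g≡h

  -- A parallel set in which every vertex has a unique dominator meets each
  -- fibre at most once: D-vertices at C5-distance one would be adjacent,
  -- and D-vertices at C5-distance two would dominate a common vertex.
  parallel-once : (D : Fin (n G) × Fin 5 → Bool) →
    UniquelyDominated (boxC5adj G) D → IsParallel G D → AtMostOncePerFibre D
  parallel-once D uniq par g i j di dj = by-offset (offset i j) dj
    where
    common : ∀ k m → C5adj i m ≡ true → C5adj k m ≡ true → D (g , k) ≡ true → k ≡ i
    common k m im km dk = cong proj₂ (trans (only (g , k) (dk , box-fibre G g k m km))
                                            (≡.sym (only (g , i) (di , box-fibre G g i m im))))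
      where
      only : ∀ v → Dominates (boxC5adj G) D (g , m) v → v ≡ proj₁ (uniq (g , m))
      only = proj₂ (proj₂ (uniq (g , m)))

    by-offset : ∀ {k} → Offset i k → D (g , k) ≡ true → i ≡ k
    by-offset same  _  = refl
    by-offset next  dk = ⊥-elim (par (g , i) (g , succ5 i) di dk (box-fibre G g i _ (c5-next i)) refl)
    by-offset prev  dk = ⊥-elim (par (g , i) (g , pred5 i) di dk (box-fibre G g i _ (c5-prev i)) refl)
    by-offset next2 dk = ≡.sym (common (plus2 i) (succ5 i) (c5-next i) (c5-next-common i) dk)
    by-offset prev2 dk = ≡.sym (common (minus2 i) (pred5 i) (c5-prev i) (c5-prev-common i) dk)

NoCrossEdges : (G : Graph) → (Fin (n G) → Fin 6) → Set
NoCrossEdges G p = ∀ i → NoEdgesBetween (adj G) (InV G p i) (InV G p (succ5 i))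

Conditions : (G : Graph) → (Fin (n G) → Fin 6) → Set
Conditions G p = CondA G p × CondB G p × NoCrossEdges G p × CondD G p

-- Given (B), condition (C') says exactly that no edge joins V_i and V_{i+1},
-- since the classes are disjoint and each induces a matching.
conditions⇔amenability : (G : Graph) (p : Fin (n G) → Fin 6) →
  Conditions G p ⇔ (CondA G p × CondB G p × CondC' G p × CondD G p)
conditions⇔amenability G p = mk⇔
  (λ (cA , cB , cX , cD) → cA , cB , (λ i → from (matching cB i) (cX i)) , cD)
  (λ (cA , cB , cC , cD) → cA , cB , (λ i → to (matching cB i) (cC i)) , cD)
  where
  matching : CondB G p → ∀ i →
    IsMatching (adj G) (λ x → InV G p i x ⊎ InV G p (succ5 i) x)
      ⇔ NoEdgesBetween (adj G) (InV G p i) (InV G p (succ5 i))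
  matching cB i = matching-∪⇔noEdges (adj G) (adj-sym G)
    (λ x vi vi+1 → succ5-no-fixpoint i (suc-injective (trans (≡.sym vi) vi+1)))
    (cB i) (cB (succ5 i))

module Characterisation (G : Graph) (p : Fin (n G) → Fin 6)
  (D : Fin (n G) × Fin 5 → Bool) (enc : Encodes p D) where

  open Encodes enc

  NeighbourIn : Fin (n G) → Fin 5 → Fin (n G) → Set
  NeighbourIn x j y = adj G x y ≡ true × InV G p j y

  Dominator : Fin (n G) → Fin 5 → Fin (n G) × Fin 5 → Set
  Dominator g j = Dominates (boxC5adj G) D (g , j)

  dominator-cases : ∀ g j h k → Dominator g j (h , k) →
    (h ≡ g × D (g , k) ≡ true × C5adj k j ≡ true) ⊎ (k ≡ j × NeighbourIn g j h)
  dominator-cases g j h k (dhk , e) with box-cases G h k g j e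
  ... | inj₁ (refl , kj) = inj₁ (refl , dhk , kj)
  ... | inj₂ (refl , hg) = inj₂ (refl , adj-sym G h g hg , label h k dhk)

  layer-dominator : ∀ g j h → NeighbourIn g j h → Dominator g j (h , j)
  layer-dominator g j h (gh , vh) = mark h j vh , box-layer G h g j (adj-sym G g h gh)

  fibre-dominator : ∀ g j k → D (g , k) ≡ true → C5adj k j ≡ true → Dominator g j (g , k)
  fibre-dominator g j k dk kj = dk , box-fibre G g k j kj

  dominated-off-fibre : ∀ g j → (∀ k → D (g , k) ≡ true → C5adj k j ≡ false) →
    ExactlyOne (Dominator g j) ⇔ ExactlyOne (NeighbourIn g j)
  dominated-off-fibre g j silent = mk⇔ neighbour dominator
    where
    neighbour : ExactlyOne (Dominator g j) → ExactlyOne (NeighbourIn g j)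
    neighbour ((h , k) , dom , only) with dominator-cases g j h k dom
    ... | inj₁ (_ , dk , kj) with () ← trans (≡.sym kj) (silent k dk)
    ... | inj₂ (refl , nh) = h , nh , λ y ny →
      cong proj₁ (only (y , j) (layer-dominator g j y ny))

    dominator : ExactlyOne (NeighbourIn g j) → ExactlyOne (Dominator g j)
    dominator (h , nh , only) = (h , j) , layer-dominator g j h nh , only-hj
      where
      only-hj : ∀ v → Dominator g j v → v ≡ (h , j)
      only-hj (h' , k) dom with dominator-cases g j h' k dom
      ... | inj₁ (_ , dk , kj) with () ← trans (≡.sym kj) (silent k dk)
      ... | inj₂ (refl , nh') = cong (_, j) (only h' nh')

  dominated-on-fibre : ∀ g j k → D (g , k) ≡ true → C5adj k j ≡ true →
    ExactlyOne (Dominator g j) ⇔ (∀ y → ¬ NeighbourIn g j y)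
  dominated-on-fibre g j k dk kj = mk⇔ none dominator
    where
    none : ExactlyOne (Dominator g j) → ∀ y → ¬ NeighbourIn g j y
    none (_ , _ , only) y ny@(gy , _) = adj-irrefl G g y gy (≡.sym (cong proj₁
      (trans (only (y , j) (layer-dominator g j y ny))
             (≡.sym (only (g , k) (fibre-dominator g j k dk kj))))))

    dominator : (∀ y → ¬ NeighbourIn g j y) → ExactlyOne (Dominator g j)
    dominator none = (g , k) , fibre-dominator g j k dk kj , only-gk
      where
      only-gk : ∀ v → Dominator g j v → v ≡ (g , k)
      only-gk (h , k') dom with dominator-cases g j h k' dom
      ... | inj₁ (refl , dk' , _) = cong (h ,_) (fibre-unique h k' k dk' dk)
      ... | inj₂ (refl , nh) = ⊥-elim (none h nh)

  silent-empty : ∀ g j → p g ≡ zero → ∀ k → D (g , k) ≡ true → C5adj k j ≡ false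
  silent-empty g j pg k dk = ⊥-elim (0≢1+n (trans (≡.sym pg) (label g k dk)))

  silent-labelled : ∀ g i j → p g ≡ suc i → C5adj i j ≡ false →
    ∀ k → D (g , k) ≡ true → C5adj k j ≡ false
  silent-labelled g i j pg ij k dk with refl ← suc-injective (trans (≡.sym (label g k dk)) pg) = ij

  uniquelyDominated⇔conditions : UniquelyDominated (boxC5adj G) D ⇔ Conditions G p
  uniquelyDominated⇔conditions = mk⇔ conditions uniquely
    where
    conditions : UniquelyDominated (boxC5adj G) D → Conditions G p
    conditions uniq = cA , cB , cX , cD
      where
      off : ∀ x i j → p x ≡ suc i → C5adj i j ≡ false → ExactlyOne (NeighbourIn x j)
      off x i j px ij = to (dominated-off-fibre x j (silent-labelled x i j px ij)) (uniq (x , j))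

      cA : CondA G p
      cA x px i = to (dominated-off-fibre x i (silent-empty x i px)) (uniq (x , i))
      cB : CondB G p
      cB i x vx = exactlyOne-map (λ _ → swap) (λ _ → swap) (off x i i vx (c5-loopless i))
      cX : NoCrossEdges G p
      cX i x z vx vz xz =
        to (dominated-on-fibre x (succ5 i) i (mark x i vx) (c5-next i)) (uniq (x , succ5 i)) z (xz , vz)
      cD : CondD G p
      cD i x vx = off x i (plus2 i) vx (c5-far-next i) , off x i (minus2 i) vx (c5-far-prev i)

    uniquely : Conditions G p → UniquelyDominated (boxC5adj G) D
    uniquely (cA , cB , cX , cD) (g , j) with p g in pg
    ... | zero  = from (dominated-off-fibre g j (silent-empty g j pg)) (cA g pg j)
    ... | suc i = by-offset (offset i j)
      where
      off : ∀ j → C5adj i j ≡ false → ExactlyOne (NeighbourIn g j) → ExactlyOne (Dominator g j)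
      off j ij = from (dominated-off-fibre g j (silent-labelled g i j pg ij))
      on : ∀ j → C5adj i j ≡ true → (∀ y → ¬ NeighbourIn g j y) → ExactlyOne (Dominator g j)
      on j ij = from (dominated-on-fibre g j i (mark g i pg) ij)
      pg' : p g ≡ suc (succ5 (pred5 i))
      pg' = trans pg (cong suc (≡.sym (succ5-pred5 i)))

      by-offset : ∀ {j} → Offset i j → ExactlyOne (Dominator g j)
      by-offset same  = off i (c5-loopless i) (exactlyOne-map (λ _ → swap) (λ _ → swap) (cB i g pg))
      by-offset next  = on (succ5 i) (c5-next i) λ y (gy , vy) → cX i g y pg vy gy
      by-offset prev  = on (pred5 i) (c5-prev i) λ y (gy , vy) →
        cX (pred5 i) y g vy pg' (adj-sym G g y gy)
      by-offset next2 = off (plus2 i) (c5-far-next i) (proj₁ (cD i g pg))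
      by-offset prev2 = off (minus2 i) (c5-far-prev i) (proj₂ (cD i g pg))

mainTheorem8 : (G : Graph) →
    (Σ (Fin (n G) × Fin 5 → Bool) λ D → IsEOD (boxC5adj G) D × IsParallel G D)
      ⇔ C5ParallelAmenable G
mainTheorem8 G = mk⇔ amenable parallelEOD
  where
  open Characterisation G

  eod⇔ : ∀ D → IsEOD (boxC5adj G) D ⇔ UniquelyDominated (boxC5adj G) D
  eod⇔ = eod⇔uniquelyDominated (boxC5adj G) (≡-dec _≟F_ _≟F_)

  amenable : Σ (Fin (n G) × Fin 5 → Bool) (λ D → IsEOD (boxC5adj G) D × IsParallel G D) →
    C5ParallelAmenable G
  amenable (D , eod , par) = labelOf D once ,
    to (conditions⇔amenability G (labelOf D once))
       (to (uniquelyDominated⇔conditions (labelOf D once) D (labelOf-encodes D once)) uniq)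
    where
    uniq : UniquelyDominated (boxC5adj G) D
    uniq = to (eod⇔ D) eod
    once : AtMostOncePerFibre D
    once = parallel-once G D uniq par

  parallelEOD : C5ParallelAmenable G →
    Σ (Fin (n G) × Fin 5 → Bool) (λ D → IsEOD (boxC5adj G) D × IsParallel G D)
  parallelEOD (p , amen) = setOf p ,
    from (eod⇔ (setOf p))
      (from (uniquelyDominated⇔conditions p (setOf p) (setOf-encodes p))
            (from (conditions⇔amenability G p) amen)) ,
    encoded-parallel G (setOf-encodes p)
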